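{- Let $\mathbf{d}_n=(d_1,\dots,d_n)$ be any degree sequence and let $v\in[n]$ be such that $\mathbb{P}(\mathfrak{t}_n(v)>0)>0$ (i.e. $d_w>1$ for some $w\ne v$). Then for every $k\ge2$ (for which the conditioning event has positive probability), $$\mathbb{P}\big(\mathfrak{t}_n(v)=j\,\big|\,\mathfrak{s}_n(v)=k,\ \mathfrak{t}_n(v)>0\big)=\frac{1}{k-1},\qquad j\in[k-1].$$
   Context: A degree sequence is $(d_1,\dots,d_n)\in\mathbb{N}_0^n$ with $\sum_j d_j=n$. $F$ uniform on $\mathfrak{F}(\mathbf{d}_n)=\{f:[n]\to[n]: |f^{ -1}(\{i\})|=d_i\ \forall i\}$. Six-length: $\mathfrak{s}_f(v)=\min\{k\in\mathbb{N}: f^{(k)}(v)\in\{f^{(j)}(v):0\le j\le k-1\}\}$ ($f^{(k)}$ the $k$-fold composition, $f^{(0)}=\mathrm{id}$); tail-length $\mathfrak{t}_f(v)$ is the unique integer with $\mathfrak{t}_f(v)<\mathfrak{s}_f(v)$ and $f^{(\mathfrak{s}_f(v))}(v)=f^{(\mathfrak{t}_f(v))}(v)$; $\mathfrak{s}_n(v)=\mathfrak{s}_F(v)$, $\mathfrak{t}_n(v)=\mathfrak{t}_F(v)$. -}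

module Defs where

open import Data.Bool using (Bool; true; false; if_then_else_)
open import Data.Nat as ℕ using (ℕ; zero; suc; _<ᵇ_)
open import Data.Fin using (Fin; _≟_)
open import Data.Vec as Vec using (Vec; []; _∷_; lookup)
open import Data.List as List using (List; [_]; concatMap; upTo; allFin; filterᵇ; length)
open import Data.Bool.ListAction using (all; any)
open import Relation.Nullary.Decidable using (⌊_⌋)

Map : ℕ → Set
Map n = Vec (Fin n) n

app : ∀ {n} → Map n → Fin n → Fin n
app f i = lookup f i

allVecs : ∀ {n} (m : ℕ) → List (Vec (Fin n) m)
allVecs zero = [ [] ]
allVecs {n} (suc m) = concatMap (λ x → List.map (x ∷_) (allVecs m)) (allFin n)

iter : ∀ {n} → Map n → ℕ → Fin n → Fin n
iter f zero x = x
iter f (suc k) x = app f (iter f k x)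

indeg : ∀ {n} → Map n → Fin n → ℕ
indeg f i = Vec.count (_≟ i) f

inF : ∀ {n} → Vec ℕ n → Map n → Bool
inF {n} d f = all (λ i → ⌊ indeg f i ℕ.≟ lookup d i ⌋) (allFin n)

𝔉 : ∀ {n} → Vec ℕ n → List (Map n)
𝔉 {n} d = filterᵇ (inF d) (allVecs n)

seenBefore : ∀ {n} → Map n → Fin n → ℕ → Bool
seenBefore f v k = any (λ j → ⌊ iter f j v ≟ iter f k v ⌋) (upTo k)

searchSix : ∀ {n} → Map n → Fin n → ℕ → ℕ → ℕ
searchSix f v k zero = k
searchSix f v k (suc fuel) = if seenBefore f v k then k else searchSix f v (suc k) fuel

-- six-length 𝔰_f(v) = min{k ≥ 1 : f^(k)(v) ∈ {f^(j)(v) : 0 ≤ j ≤ k-1}}.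
-- By pigeonhole this minimum is ≤ n, so a search over k = 1..n+1 finds it.
six : ∀ {n} → Map n → Fin n → ℕ
six {n} f v = searchSix f v 1 n

searchTail : ∀ {n} → Map n → Fin n → Fin n → ℕ → ℕ → ℕ
searchTail f v t j zero = j
searchTail f v t j (suc fuel) = if ⌊ iter f j v ≟ t ⌋ then j else searchTail f v t (suc j) fuel

-- tail-length 𝔱_f(v): the unique j < 𝔰_f(v) with f^(𝔰_f(v))(v) = f^(j)(v)
-- (unique since f^(0)(v),…,f^(𝔰-1)(v) are distinct by minimality of 𝔰).
tail : ∀ {n} → Map n → Fin n → ℕ
tail f v = searchTail f v (iter f (six f v) v) 0 (six f v)

#𝔉 : ∀ {n} → Vec ℕ n → (Map n → Bool) → ℕ
#𝔉 d P = length (filterᵇ P (𝔉 d))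

_∧ᵇ_ : Bool → Bool → Bool
true ∧ᵇ b = b
false ∧ᵇ b = false

evTailPos : ∀ {n} → Fin n → Map n → Bool
evTailPos v f = 0 <ᵇ tail f v

evSixTailPos : ∀ {n} → Fin n → ℕ → Map n → Bool
evSixTailPos v k f = ⌊ six f v ℕ.≟ k ⌋ ∧ᵇ (0 <ᵇ tail f v)

evSixTail : ∀ {n} → Fin n → ℕ → ℕ → Map n → Bool
evSixTail v k j f = ⌊ six f v ℕ.≟ k ⌋ ∧ᵇ ⌊ tail f v ℕ.≟ j ⌋

-- Write x_i = fⁱ v and fix k. For 1 ≤ j < k − 1, precomposing f with the 3-cycle
-- x_{j−1} ↦ x_j ↦ x_{j+1} ↦ x_{j−1} keeps all in-degrees, and on maps with 𝔰(v) = k it swaps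
-- x_j and x_{j+1} along the orbit of v. This is an involution of 𝔉(d) exchanging the events
-- {𝔰 = k, 𝔱 = j} and {𝔰 = k, 𝔱 = j + 1}, so #{𝔰 = k, 𝔱 = j} is the same for all j ∈ [1, k − 1],
-- and {𝔰 = k, 𝔱 > 0} is the disjoint union of these k − 1 events.

module Submission where

open import Defs
open import Data.Nat using (ℕ; _≤_; _<_; _*_; _∸_)
open import Data.Vec using (Vec; sum)
open import Data.Fin using (Fin)
open import Relation.Binary.PropositionalEquality using (_≡_)

open import Data.Bool using (Bool; true; false; T; not; _∧_; _∨_; if_then_else_)
open import Data.Bool.ListAction using (and)
open import Data.Bool.Properties using (T-≡; T-∧; T-∨; ∧-zeroʳ; ∧-identityʳ)
open import Data.Empty using (⊥-elim)
open import Data.Fin as Fin using (toℕ)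
import Data.Fin.Properties as Finₚ
open import Data.Fin.Permutation using (Permutation′; permutation; _⟨$⟩ʳ_; _∘ₚ_)
open import Data.List using (List; []; _∷_; map; filterᵇ; length; upTo; allFin)
open import Data.List.Membership.Propositional using (_∈_; find; lose)
open import Data.List.Membership.Propositional.Properties
  using (∈-map⁺; ∈-map⁻; ∈-concat⁺′; ∈-allFin; ∈-filter⁺; ∈-filter⁻; ∈-upTo⁺; ∈-upTo⁻)
open import Data.List.Membership.Propositional.Properties.WithK using (unique∧set⇒bag)
open import Data.List.Properties using (filter-≐; filter-none; map-cong)
open import Data.List.Relation.Binary.BagAndSetEquality using (∼bag⇒↭)
open import Data.List.Relation.Binary.Disjoint.Propositional using (Disjoint)
open import Data.List.Relation.Binary.Permutation.Propositional using (_↭_; ↭-sym)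
open import Data.List.Relation.Binary.Permutation.Propositional.Properties
  using (↭-length; filter-↭)
import Data.List.Relation.Unary.All as All
open import Data.List.Relation.Unary.Any using (here)
open import Data.List.Relation.Unary.Any.Properties using (any⁺; any⁻)
import Data.List.Relation.Unary.AllPairs as AllPairs
import Data.List.Relation.Unary.AllPairs.Properties as AllPairsₚ
open import Data.List.Relation.Unary.Unique.Propositional using (Unique)
import Data.List.Relation.Unary.Unique.Propositional.Properties as Uniqueₚ
open import Data.Nat as ℕ using (zero; suc; _+_; z≤n; s≤s)
open import Data.Nat.Properties
  using (≤-refl; ≤-trans; ≤-<-trans; <-trans; <⇒≤; <⇒≢; >⇒≢; <⇒≱; ≮⇒≥; ≤∧≢⇒<; ≤-pred; 1+n≢n;
         n<1+n; m<n⇒m<1+n; m≤n⇒m≤1+n; m≤n⇒m<n∨m≡n; <-cmp; <ᵇ⇒<; <⇒<ᵇ; suc-injective; +-suc;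
         +-identityʳ; +-0-commutativeMonoid)
open import Data.Product using (∃-syntax; _×_; _,_; proj₁; proj₂; map₂)
open import Data.Sum using (_⊎_; inj₁; inj₂)
open import Data.Unit using (tt)
open import Data.Vec as Vec using ([]; _∷_; tabulate; lookup)
open import Data.Vec.Properties
  using (lookup∘tabulate; tabulate∘lookup; tabulate-cong; ∷-injectiveˡ; ∷-injectiveʳ)
open import Function using (_∘_; _⇔_; mk⇔; Equivalence)
open import Relation.Binary.Definitions using (DecidableEquality; tri<; tri≈; tri>)
open import Relation.Binary.PropositionalEquality
  using (refl; sym; trans; cong; cong₂; subst; _≢_; _≗_; module ≡-Reasoning)
open import Relation.Nullary using (¬_; Dec; yes; no; does; contradiction)
import Relation.Nullary.Decidable as Dec
open import Relation.Nullary.Decidable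
  using (⌊_⌋; T?; toWitness; fromWitness; toWitnessFalse; fromWitnessFalse)
open import Relation.Unary using (Pred; Decidable)
open import Level using (0ℓ)
open import Algebra.Properties.CommutativeMonoid.Sum +-0-commutativeMonoid
  using (sum-permute) renaming (sum to ∑)

open ≡-Reasoning

module _ {A : Set} (_≟_ : DecidableEquality A) where

  transpose : A → A → A → A
  transpose i j m with m ≟ i
  ... | yes _ = j
  ... | no _ with m ≟ j
  ...   | yes _ = i
  ...   | no _  = m

  transpose-matchˡ : ∀ i j → transpose i j i ≡ j
  transpose-matchˡ i j with i ≟ i
  ... | yes _   = refl
  ... | no i≢i = contradiction refl i≢i

  transpose-matchʳ : ∀ i j → transpose i j j ≡ i
  transpose-matchʳ i j with j ≟ i
  ... | yes j≡i = j≡i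
  ... | no _ with j ≟ j
  ...   | yes _   = refl
  ...   | no j≢j = contradiction refl j≢j

  transpose-other : ∀ {i j m} → m ≢ i → m ≢ j → transpose i j m ≡ m
  transpose-other {i} {j} {m} m≢i m≢j with m ≟ i
  ... | yes m≡i = contradiction m≡i m≢i
  ... | no _ with m ≟ j
  ...   | yes m≡j = contradiction m≡j m≢j
  ...   | no _    = refl

  transpose-involutive : ∀ i j m → transpose i j (transpose i j m) ≡ m
  transpose-involutive i j m with m ≟ i
  ... | yes refl = transpose-matchʳ m j
  ... | no m≢i with m ≟ j
  ...   | yes refl = transpose-matchˡ i m
  ...   | no m≢j   = transpose-other m≢i m≢j

  transpose-injective : ∀ i j {m m′} → transpose i j m ≡ transpose i j m′ → m ≡ m′
  transpose-injective i j {m} {m′} eq = begin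
    m                                 ≡⟨ transpose-involutive i j m ⟨
    transpose i j (transpose i j m)   ≡⟨ cong (transpose i j) eq ⟩
    transpose i j (transpose i j m′)  ≡⟨ transpose-involutive i j m′ ⟩
    m′                                ∎

  transpose-preserves : ∀ {p} (P : Pred A p) {i j m} → P i → P j → P m → P (transpose i j m)
  transpose-preserves P {i} {j} {m} Pi Pj Pm with m ≟ i
  ... | yes _ = Pj
  ... | no _ with m ≟ j
  ...   | yes _ = Pi
  ...   | no _  = Pm

transpose-natural : ∀ {A B : Set} (_≟ᴬ_ : DecidableEquality A) (_≟ᴮ_ : DecidableEquality B)
                    (φ : A → B) {i j m} → (φ m ≡ φ i → m ≡ i) → (φ m ≡ φ j → m ≡ j) →
                    transpose _≟ᴮ_ (φ i) (φ j) (φ m) ≡ φ (transpose _≟ᴬ_ i j m)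
transpose-natural _≟ᴬ_ _≟ᴮ_ φ {i} {j} {m} injᵢ injⱼ with m ≟ᴬ i
... | yes refl = transpose-matchˡ _≟ᴮ_ (φ m) (φ j)
... | no m≢i with m ≟ᴬ j
...   | yes refl = transpose-matchʳ _≟ᴮ_ (φ i) (φ m)
...   | no m≢j   = transpose-other _≟ᴮ_ (m≢i ∘ injᵢ) (m≢j ∘ injⱼ)

linearSearch : (ℕ → Bool) → ℕ → ℕ → ℕ
linearSearch p s zero       = s
linearSearch p s (suc fuel) = if p s then s else linearSearch p (suc s) fuel

linearSearch-minimal : ∀ (p : ℕ → Bool) s fuel {i} → s ≤ i → i < linearSearch p s fuel → ¬ T (p i)
linearSearch-minimal p s zero s≤i i<s = contradiction s≤i (<⇒≱ i<s)
linearSearch-minimal p s (suc fuel) s≤i i<r with p s in ps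
... | true = contradiction s≤i (<⇒≱ i<r)
... | false with m≤n⇒m<n∨m≡n s≤i
...   | inj₁ s<i  = linearSearch-minimal p (suc s) fuel s<i i<r
...   | inj₂ refl = subst T ps

linearSearch-finds : ∀ (p : ℕ → Bool) s fuel {i} → s ≤ i → i < s + fuel → T (p i) →
                     T (p (linearSearch p s fuel))
linearSearch-finds p s zero s≤i i<s+0 _ =
  contradiction s≤i (<⇒≱ (subst (_ <_) (+-identityʳ s) i<s+0))
linearSearch-finds p s (suc fuel) {i} s≤i i<s+1+fuel pi with p s in ps
... | true = subst T (sym ps) tt
... | false with m≤n⇒m<n∨m≡n s≤i
...   | inj₁ s<i  = linearSearch-finds p (suc s) fuel s<i (subst (i <_) (+-suc s fuel) i<s+1+fuel) pi
...   | inj₂ refl = ⊥-elim (subst T ps pi)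

module _ {A : Set} where

  count : (A → Bool) → List A → ℕ
  count p xs = length (filterᵇ p xs)

  count-cong : ∀ {p q : A → Bool} → (∀ {x} → T (p x) ⇔ T (q x)) → ∀ xs → count p xs ≡ count q xs
  count-cong p⇔q xs =
    cong length (filter-≐ (T? ∘ _) (T? ∘ _) (Equivalence.to p⇔q , Equivalence.from p⇔q) xs)

  count-≗ : ∀ {p q : A → Bool} → p ≗ q → ∀ xs → count p xs ≡ count q xs
  count-≗ p≗q = count-cong (λ {x} → mk⇔ (subst T (p≗q x)) (subst T (sym (p≗q x))))

  count-none : ∀ (p : A → Bool) xs → (∀ x → ¬ T (p x)) → count p xs ≡ 0
  count-none p xs ¬p = cong length (filter-none (T? ∘ p) (All.universal ¬p xs))

  count-∧-split : ∀ (p q : A → Bool) xs →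
                  count p xs ≡ count (λ x → p x ∧ q x) xs + count (λ x → p x ∧ not (q x)) xs
  count-∧-split p q [] = refl
  count-∧-split p q (x ∷ xs) with p x | q x
  ... | false | _     = count-∧-split p q xs
  ... | true  | true  = cong suc (count-∧-split p q xs)
  ... | true  | false = trans (cong suc (count-∧-split p q xs)) (sym (+-suc _ _))

  count-map : ∀ (p : A → Bool) (σ : A → A) xs → count p (map σ xs) ≡ count (p ∘ σ) xs
  count-map p σ [] = refl
  count-map p σ (x ∷ xs) with p (σ x)
  ... | true  = cong suc (count-map p σ xs)
  ... | false = count-map p σ xs

  count-↭ : ∀ (p : A → Bool) {xs ys} → xs ↭ ys → count p xs ≡ count p ys
  count-↭ p xs↭ys = ↭-length (filter-↭ _ xs↭ys)

  count-∘-involution : ∀ (p : A → Bool) {σ : A → A} → (∀ x → σ (σ x) ≡ x) →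
                       ∀ {xs} → Unique xs → (∀ {x} → x ∈ xs → σ x ∈ xs) →
                       count p xs ≡ count (p ∘ σ) xs
  count-∘-involution p {σ} σσ {xs} !xs closed = begin
    count p xs          ≡⟨ count-↭ p (↭-sym map-σ-↭) ⟩
    count p (map σ xs)  ≡⟨ count-map p σ xs ⟩
    count (p ∘ σ) xs    ∎
    where
    σ-injective : ∀ {x y} → σ x ≡ σ y → x ≡ y
    σ-injective {x} {y} eq = trans (sym (σσ x)) (trans (cong σ eq) (σσ y))

    map-σ-↭ : map σ xs ↭ xs
    map-σ-↭ = ∼bag⇒↭ (unique∧set⇒bag (Uniqueₚ.map⁺ σ-injective !xs) !xs (mk⇔ into onto))
      where
      into : ∀ {y} → y ∈ map σ xs → y ∈ xs
      into y∈ with _ , x∈ , refl ← ∈-map⁻ σ y∈ = closed x∈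
      onto : ∀ {y} → y ∈ xs → y ∈ map σ xs
      onto {y} y∈ = subst (_∈ map σ xs) (σσ y) (∈-map⁺ σ (closed y∈))

  -- φ is extended to a global involution σ by letting it act only on p ∪ q.
  count-exchange : ∀ (p q : A → Bool) (φ : A → A) {xs} →
                   Unique xs → (∀ {x} → x ∈ xs → φ x ∈ xs) →
                   (∀ {x} → T (p x) → T (q (φ x))) → (∀ {x} → T (q x) → T (p (φ x))) →
                   (∀ {x} → T (p x) ⊎ T (q x) → φ (φ x) ≡ x) → (∀ {x} → T (p x) → ¬ T (q x)) →
                   count p xs ≡ count q xs
  count-exchange p q φ {xs} !xs closed p→q q→p φφ disjoint =
    trans (count-∘-involution p σσ !xs σ-closed) (count-cong (mk⇔ p∘σ→q q→p∘σ) xs)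
    where
    σ : A → A
    σ x = if p x ∨ q x then φ x else x

    σ-on : ∀ {x} → T (p x) ⊎ T (q x) → σ x ≡ φ x
    σ-on {x} pq with p x ∨ q x in eq
    ... | true  = refl
    ... | false = contradiction (subst T eq (Equivalence.from T-∨ pq)) λ ()

    σ-off : ∀ {x} → ¬ (T (p x) ⊎ T (q x)) → σ x ≡ x
    σ-off {x} ¬pq with p x ∨ q x in eq
    ... | true  = contradiction (Equivalence.to T-∨ (subst T (sym eq) tt)) ¬pq
    ... | false = refl

    φ-pq : ∀ {x} → T (p x) ⊎ T (q x) → T (p (φ x)) ⊎ T (q (φ x))
    φ-pq (inj₁ px) = inj₂ (p→q px)
    φ-pq (inj₂ qx) = inj₁ (q→p qx)

    decide : ∀ x → Dec (T (p x) ⊎ T (q x))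
    decide x = Dec.map T-∨ (T? (p x ∨ q x))

    σσ : ∀ x → σ (σ x) ≡ x
    σσ x with decide x
    ... | yes pq = trans (cong σ (σ-on pq)) (trans (σ-on (φ-pq pq)) (φφ pq))
    ... | no ¬pq = trans (cong σ (σ-off ¬pq)) (σ-off ¬pq)

    σ-closed : ∀ {x} → x ∈ xs → σ x ∈ xs
    σ-closed {x} x∈ with decide x
    ... | yes pq = subst (_∈ xs) (sym (σ-on pq)) (closed x∈)
    ... | no ¬pq = subst (_∈ xs) (sym (σ-off ¬pq)) x∈

    p∘σ→q : ∀ {x} → T (p (σ x)) → T (q x)
    p∘σ→q {x} pσx with decide x
    ... | yes (inj₂ qx) = qx
    ... | yes (inj₁ px) =
      contradiction (p→q px) (disjoint (subst (T ∘ p) (σ-on (inj₁ px)) pσx))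
    ... | no ¬pq        = contradiction (inj₁ (subst (T ∘ p) (σ-off ¬pq) pσx)) ¬pq

    q→p∘σ : ∀ {x} → T (q x) → T (p (σ x))
    q→p∘σ qx = subst (T ∘ p) (sym (σ-on (inj₂ qx))) (q→p qx)

∧-absorbs-implied : ∀ b {c d} → (T d → T c) → (b ∧ c) ∧ d ≡ b ∧ d
∧-absorbs-implied b {true}  {true}  _   = cong (_∧ true) (∧-identityʳ b)
∧-absorbs-implied b {false} {true}  d⇒c = ⊥-elim (d⇒c tt)
∧-absorbs-implied b {c}     {false} _   = trans (∧-zeroʳ _) (sym (∧-zeroʳ b))

count-fibres : ∀ {A : Set} (h : A → ℕ) (xs : List A) {c} m (p : A → Bool) →
               (∀ x → T (p x) → 1 ≤ h x × h x ≤ m) →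
               (∀ t → 1 ≤ t → t ≤ m → count (λ x → p x ∧ ⌊ h x ℕ.≟ t ⌋) xs ≡ c) →
               count p xs ≡ m * c
count-fibres h xs zero p range fibre =
  count-none p xs λ x px → let 1≤hx , hx≤0 = range x px in contradiction (≤-trans 1≤hx hx≤0) λ ()
count-fibres h xs {c} (suc m) p range fibre = begin
  count p xs                                    ≡⟨ count-∧-split p top xs ⟩
  count (λ x → p x ∧ top x) xs + count rest xs  ≡⟨ cong₂ _+_ (fibre (suc m) (s≤s z≤n) ≤-refl)
                                                           (count-fibres h xs m rest range′ fibre′) ⟩
  c + m * c                                     ∎
  where
  top rest : _ → Bool
  top x  = ⌊ h x ℕ.≟ suc m ⌋
  rest x = p x ∧ not (top x)

  range′ : ∀ x → T (rest x) → 1 ≤ h x × h x ≤ m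
  range′ x rx with px , ¬top ← Equivalence.to (T-∧ {p x}) rx =
    proj₁ (range x px) , ≤-pred (≤∧≢⇒< (proj₂ (range x px)) (toWitnessFalse ¬top))

  fibre′ : ∀ t → 1 ≤ t → t ≤ m → count (λ x → rest x ∧ ⌊ h x ℕ.≟ t ⌋) xs ≡ c
  fibre′ t 1≤t t≤m = trans (count-≗ same xs) (fibre t 1≤t (m≤n⇒m≤1+n t≤m))
    where
    same : ∀ x → rest x ∧ ⌊ h x ℕ.≟ t ⌋ ≡ p x ∧ ⌊ h x ℕ.≟ t ⌋
    same x = ∧-absorbs-implied (p x) λ ht →
      fromWitnessFalse λ hx≡1+m → <⇒≢ (s≤s t≤m) (trans (sym (toWitness ht)) hx≡1+m)

allVecs-complete : ∀ {n} m (xs : Vec (Fin n) m) → xs ∈ allVecs m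
allVecs-complete zero    []       = here refl
allVecs-complete (suc m) (x ∷ xs) =
  ∈-concat⁺′ (∈-map⁺ (x ∷_) (allVecs-complete m xs))
             (∈-map⁺ (λ y → map (y ∷_) (allVecs m)) (∈-allFin x))

allVecs-unique : ∀ {n} m → Unique (allVecs {n} m)
allVecs-unique zero = All.[] AllPairs.∷ AllPairs.[]
allVecs-unique {n} (suc m) =
  Uniqueₚ.concat⁺ (All.tabulate unique-block) (AllPairsₚ.map⁺ (AllPairs.map disjoint (Uniqueₚ.allFin⁺ n)))
  where
  block : Fin n → List (Vec (Fin n) (suc m))
  block x = map (x ∷_) (allVecs m)

  unique-block : ∀ {ys} → ys ∈ map block (allFin n) → Unique ys
  unique-block ys∈ with _ , _ , refl ← ∈-map⁻ block ys∈ =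
    Uniqueₚ.map⁺ ∷-injectiveʳ (allVecs-unique m)

  disjoint : ∀ {x y} → x ≢ y → Disjoint (block x) (block y)
  disjoint x≢y (∈x , ∈y) with _ , _ , refl ← ∈-map⁻ _ ∈x | _ , _ , eq ← ∈-map⁻ _ ∈y =
    x≢y (∷-injectiveˡ eq)

module _ {n} (d : Vec ℕ n) where

  ∈-𝔉⁺ : ∀ {f} → T (inF d f) → f ∈ 𝔉 d
  ∈-𝔉⁺ {f} f∈ = ∈-filter⁺ (T? ∘ inF d) (allVecs-complete n f) f∈

  ∈-𝔉⁻ : ∀ {f} → f ∈ 𝔉 d → T (inF d f)
  ∈-𝔉⁻ f∈ = proj₂ (∈-filter⁻ (T? ∘ inF d) {xs = allVecs n} f∈)

  𝔉-unique : Unique (𝔉 d)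
  𝔉-unique = Uniqueₚ.filter⁺ _ (allVecs-unique n)

_∘ᵐ_ : ∀ {n} → Map n → Permutation′ n → Map n
f ∘ᵐ π = tabulate (app f ∘ (π ⟨$⟩ʳ_))

module _ {A : Set} {P : Pred A 0ℓ} (P? : Decidable P) where

  private
    indicator : A → ℕ
    indicator x = if does (P? x) then 1 else 0

  count-tabulate : ∀ {m} (g : Fin m → A) → Vec.count P? (tabulate g) ≡ ∑ (indicator ∘ g)
  count-tabulate {zero}  g = refl
  count-tabulate {suc m} g with does (P? (g Fin.zero))
  ... | true  = cong suc (count-tabulate (g ∘ Fin.suc))
  ... | false = count-tabulate (g ∘ Fin.suc)

  count-permute : ∀ {m} (xs : Vec A m) (π : Permutation′ m) →
                  Vec.count P? (tabulate (lookup xs ∘ (π ⟨$⟩ʳ_))) ≡ Vec.count P? xs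
  count-permute xs π = begin
    Vec.count P? (tabulate (lookup xs ∘ (π ⟨$⟩ʳ_)))  ≡⟨ count-tabulate (lookup xs ∘ (π ⟨$⟩ʳ_)) ⟩
    ∑ (indicator ∘ lookup xs ∘ (π ⟨$⟩ʳ_))            ≡⟨ sum-permute (indicator ∘ lookup xs) π ⟨
    ∑ (indicator ∘ lookup xs)                         ≡⟨ count-tabulate (lookup xs) ⟨
    Vec.count P? (tabulate (lookup xs))               ≡⟨ cong (Vec.count P?) (tabulate∘lookup xs) ⟩
    Vec.count P? xs                                   ∎

module _ {n} (d : Vec ℕ n) where

  inF-∘ᵐ : ∀ f (π : Permutation′ n) → inF d (f ∘ᵐ π) ≡ inF d f
  inF-∘ᵐ f π = cong and (map-cong same-degree (allFin n))
    where
    same-degree : ∀ i → ⌊ indeg (f ∘ᵐ π) i ℕ.≟ lookup d i ⌋ ≡ ⌊ indeg f i ℕ.≟ lookup d i ⌋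
    same-degree i = cong (λ m → ⌊ m ℕ.≟ lookup d i ⌋) (count-permute (Fin._≟ i) f π)

  ∘ᵐ-∈-𝔉 : ∀ {f} (π : Permutation′ n) → f ∈ 𝔉 d → f ∘ᵐ π ∈ 𝔉 d
  ∘ᵐ-∈-𝔉 {f} π f∈ = ∈-𝔉⁺ d (subst T (sym (inF-∘ᵐ f π)) (∈-𝔉⁻ d f∈))

-- ρ-shaped orbits

record Rho {n} (f : Map n) (v : Fin n) (k t : ℕ) : Set where
  field
    injective : ∀ {i j} → i < k → j < k → iter f i v ≡ iter f j v → i ≡ j
    closes    : iter f k v ≡ iter f t v
    tail<     : t < k

module _ {n} (f : Map n) (v : Fin n) where

  Rho-not-shorter : ∀ {k t k′ t′} → Rho f v k t → Rho f v k′ t′ → ¬ k < k′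
  Rho-not-shorter ρ ρ′ k<k′ =
    <⇒≢ (Rho.tail< ρ) (Rho.injective ρ′ (<-trans (Rho.tail< ρ) k<k′) k<k′ (sym (Rho.closes ρ)))

  Rho-unique : ∀ {k t k′ t′} → Rho f v k t → Rho f v k′ t′ → k ≡ k′ × t ≡ t′
  Rho-unique {k} {_} {k′} ρ ρ′ with <-cmp k k′
  ... | tri< k<k′ _ _ = contradiction k<k′ (Rho-not-shorter ρ ρ′)
  ... | tri> _ _ k′<k = contradiction k′<k (Rho-not-shorter ρ′ ρ)
  ... | tri≈ _ refl _ =
    refl , Rho.injective ρ (Rho.tail< ρ) (Rho.tail< ρ′) (trans (sym (Rho.closes ρ)) (Rho.closes ρ′))

  seenBefore-sound : ∀ k → T (seenBefore f v k) → ∃[ t ] t < k × iter f t v ≡ iter f k v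
  seenBefore-sound k seen with t , t∈ , eq ← find (any⁻ _ (upTo k) seen) = t , ∈-upTo⁻ t∈ , toWitness eq

  seenBefore-complete : ∀ {t k} → t < k → iter f t v ≡ iter f k v → T (seenBefore f v k)
  seenBefore-complete t<k eq = any⁺ _ (lose (∈-upTo⁺ t<k) (fromWitness eq))

  searchSix-linearSearch : ∀ s fuel → searchSix f v s fuel ≡ linearSearch (seenBefore f v) s fuel
  searchSix-linearSearch s zero       = refl
  searchSix-linearSearch s (suc fuel) =
    cong (λ r → if seenBefore f v s then s else r) (searchSix-linearSearch (suc s) fuel)

  searchTail-linearSearch : ∀ x s fuel →
                            searchTail f v x s fuel ≡ linearSearch (λ i → ⌊ iter f i v Fin.≟ x ⌋) s fuel
  searchTail-linearSearch x s zero       = refl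
  searchTail-linearSearch x s (suc fuel) =
    cong (λ r → if ⌊ iter f s v Fin.≟ x ⌋ then s else r) (searchTail-linearSearch x (suc s) fuel)

  -- Pigeonhole on v, f v, …, fⁿ v provides a repetition within the search range.
  seenBefore-six : T (seenBefore f v (six f v))
  seenBefore-six with i , j , i<j , eq ← Finₚ.pigeonhole (n<1+n n) (λ i → iter f (toℕ i) v) =
    subst (T ∘ seenBefore f v) (sym (searchSix-linearSearch 1 n))
      (linearSearch-finds (seenBefore f v) 1 n (≤-trans (s≤s z≤n) i<j) (Finₚ.toℕ<n j)
                          (seenBefore-complete i<j eq))

  no-repeat-before-six : ∀ {i j} → i < j → j < six f v → iter f i v ≢ iter f j v
  no-repeat-before-six i<j j<six eq =
    linearSearch-minimal (seenBefore f v) 1 n (≤-trans (s≤s z≤n) i<j)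
      (subst (_ <_) (searchSix-linearSearch 1 n) j<six) (seenBefore-complete i<j eq)

  six-injective : ∀ {i j} → i < six f v → j < six f v → iter f i v ≡ iter f j v → i ≡ j
  six-injective {i} {j} i<six j<six eq with <-cmp i j
  ... | tri< i<j _ _ = contradiction eq (no-repeat-before-six i<j j<six)
  ... | tri≈ _ i≡j _ = i≡j
  ... | tri> _ _ j<i = contradiction (sym eq) (no-repeat-before-six j<i i<six)

  tail-first-return : ∀ {t₀} → t₀ < six f v → iter f t₀ v ≡ iter f (six f v) v →
                      tail f v ≤ t₀ × iter f (tail f v) v ≡ iter f (six f v) v
  tail-first-return {t₀} t₀<six t₀-returns = ≮⇒≥ tail≯t₀ , toWitness tail-returns
    where
    returns : ℕ → Bool
    returns i = ⌊ iter f i v Fin.≟ iter f (six f v) v ⌋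

    t₀-returns′ : T (returns t₀)
    t₀-returns′ = fromWitness t₀-returns

    tail-search : tail f v ≡ linearSearch returns 0 (six f v)
    tail-search = searchTail-linearSearch _ 0 (six f v)

    tail≯t₀ : ¬ t₀ < tail f v
    tail≯t₀ t₀<tail =
      linearSearch-minimal returns 0 (six f v) z≤n (subst (t₀ <_) tail-search t₀<tail) t₀-returns′

    tail-returns : T (returns (tail f v))
    tail-returns =
      subst (T ∘ returns) (sym tail-search) (linearSearch-finds returns 0 (six f v) z≤n t₀<six t₀-returns′)

  Rho-six-tail : Rho f v (six f v) (tail f v)
  Rho-six-tail with t₀ , t₀<six , t₀-returns ← seenBefore-sound (six f v) seenBefore-six
               with tail≤t₀ , tail-returns ← tail-first-return t₀<six t₀-returns = record
    { injective = six-injective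
    ; closes    = sym tail-returns
    ; tail<     = ≤-<-trans tail≤t₀ t₀<six
    }

module _ {n} {f : Map n} {v : Fin n} where

  evSixTail⇒Rho : ∀ {k t} → T (evSixTail v k t f) → Rho f v k t
  evSixTail⇒Rho {k} {t} ev with six f v ℕ.≟ k | tail f v ℕ.≟ t
  ... | yes refl | yes refl = Rho-six-tail f v

  Rho⇒evSixTail : ∀ {k t} → Rho f v k t → T (evSixTail v k t f)
  Rho⇒evSixTail {k} {t} ρ with Rho-unique f v (Rho-six-tail f v) ρ | six f v ℕ.≟ k | tail f v ℕ.≟ t
  ... | _ , _         | yes _   | yes _   = tt
  ... | six≡k , _     | no six≢k | _      = contradiction six≡k six≢k
  ... | _ , tail≡t    | yes _   | no tail≢t = contradiction tail≡t tail≢t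

-- Exchanging two consecutive points of the orbit

transpositionᶠ : ∀ {n} → Fin n → Fin n → Permutation′ n
transpositionᶠ i j = permutation (transpose Fin._≟_ i j) (transpose Fin._≟_ i j)
                       (transpose-involutive Fin._≟_ i j) (transpose-involutive Fin._≟_ i j)

-- x_p ↦ x_{p+1} ↦ x_{p+2} ↦ x_p, where x_i = fⁱ v
orbitCycle : ∀ {n} → Fin n → ℕ → Map n → Permutation′ n
orbitCycle v p f =
  transpositionᶠ (iter f p v) (iter f (suc p) v) ∘ₚ transpositionᶠ (iter f p v) (iter f (2 + p) v)

-- Keeps every in-degree; if x_0, …, x_{p+2} are distinct, the orbit of v now visits x_{p+2} before x_{p+1}.
exchange : ∀ {n} → Fin n → ℕ → Map n → Map n
exchange v p f = f ∘ᵐ orbitCycle v p f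

app-exchange : ∀ {n} (v : Fin n) p f {c a b} →
               iter f p v ≡ c → iter f (suc p) v ≡ a → iter f (2 + p) v ≡ b →
               ∀ y → app (exchange v p f) y ≡ app f (transpose Fin._≟_ c b (transpose Fin._≟_ c a y))
app-exchange v p f refl refl refl y = lookup∘tabulate _ y

module _ {n} {f : Map n} {v : Fin n} {k t : ℕ} (ρ : Rho f v k t) {p : ℕ} (2+p<k : 2 + p < k) where

  private
    open Rho ρ

    x : ℕ → Fin n
    x i = iter f i v

    g : Map n
    g = exchange v p f

    τ σ₁ σ₂ : ℕ → ℕ
    τ  = transpose ℕ._≟_ (suc p) (2 + p)
    σ₁ = transpose ℕ._≟_ p (suc p)
    σ₂ = transpose ℕ._≟_ p (2 + p)

    1+p<k : suc p < k
    1+p<k = <-trans (n<1+n _) 2+p<k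

    p<k : p < k
    p<k = <-trans (n<1+n _) 1+p<k

    τ< : ∀ {i} → i < k → τ i < k
    τ< = transpose-preserves ℕ._≟_ (_< k) 1+p<k 2+p<k

    σ₁< : ∀ {i} → i < k → σ₁ i < k
    σ₁< = transpose-preserves ℕ._≟_ (_< k) p<k 1+p<k

    τ-fixes-k : τ k ≡ k
    τ-fixes-k = transpose-other ℕ._≟_ (<⇒≢ 1+p<k ∘ sym) (<⇒≢ 2+p<k ∘ sym)

    orbit-transpose : ∀ {i j m} → i < k → j < k → m < k →
                      transpose Fin._≟_ (x i) (x j) (x m) ≡ x (transpose ℕ._≟_ i j m)
    orbit-transpose i<k j<k m<k = transpose-natural ℕ._≟_ Fin._≟_ x (injective m<k i<k) (injective m<k j<k)

    tr₀₁ tr₀₂ : Fin n → Fin n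
    tr₀₁ = transpose Fin._≟_ (x p) (x (suc p))
    tr₀₂ = transpose Fin._≟_ (x p) (x (2 + p))

    -- Conjugating (p+1 p+2) by (p p+1) gives (p p+2).
    σ₂σ₁τ : ∀ i → σ₂ (σ₁ (τ i)) ≡ σ₁ i
    σ₂σ₁τ i = begin
      σ₂ (σ₁ (τ i))
        ≡⟨ cong₂ (λ a b → transpose ℕ._≟_ a b (σ₁ (τ i))) (transpose-matchʳ ℕ._≟_ p (suc p)) σ₁-fixes-2+p ⟨
      transpose ℕ._≟_ (σ₁ (suc p)) (σ₁ (2 + p)) (σ₁ (τ i))
        ≡⟨ transpose-natural ℕ._≟_ ℕ._≟_ σ₁ {suc p} {2 + p} {τ i} σ₁-injective σ₁-injective ⟩
      σ₁ (τ (τ i))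
        ≡⟨ cong σ₁ (transpose-involutive ℕ._≟_ (suc p) (2 + p) i) ⟩
      σ₁ i
        ∎
      where
      σ₁-injective : ∀ {m m′} → σ₁ m ≡ σ₁ m′ → m ≡ m′
      σ₁-injective = transpose-injective ℕ._≟_ p (suc p)

      σ₁-fixes-2+p : σ₁ (2 + p) ≡ 2 + p
      σ₁-fixes-2+p = transpose-other ℕ._≟_ (>⇒≢ (m<n⇒m<1+n (n<1+n p))) 1+n≢n

    suc-σ₁ : ∀ i → suc (σ₁ i) ≡ τ (suc i)
    suc-σ₁ i = sym (transpose-natural ℕ._≟_ ℕ._≟_ suc {p} {suc p} {i} suc-injective suc-injective)

    exchange-step : ∀ i → i < k → app g (x (τ i)) ≡ x (τ (suc i))
    exchange-step i i<k = begin
      app g (x (τ i))              ≡⟨ app-exchange v p f refl refl refl _ ⟩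
      app f (tr₀₂ (tr₀₁ (x (τ i))))  ≡⟨ cong (app f ∘ tr₀₂) (orbit-transpose p<k 1+p<k (τ< i<k)) ⟩
      app f (tr₀₂ (x (σ₁ (τ i))))    ≡⟨ cong (app f) (orbit-transpose p<k 2+p<k (σ₁< (τ< i<k))) ⟩
      app f (x (σ₂ (σ₁ (τ i))))      ≡⟨ cong (app f ∘ x) (σ₂σ₁τ i) ⟩
      x (suc (σ₁ i))               ≡⟨ cong x (suc-σ₁ i) ⟩
      x (τ (suc i))                ∎

  exchange-orbit : ∀ i → i ≤ k → iter (exchange v p f) i v ≡ iter f (transpose ℕ._≟_ (suc p) (2 + p) i) v
  exchange-orbit zero    _   = cong x (sym (transpose-other ℕ._≟_ {suc p} {2 + p} {0} (λ ()) (λ ())))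
  exchange-orbit (suc i) i<k = trans (cong (app g) (exchange-orbit i (<⇒≤ i<k))) (exchange-step i i<k)

  private
    g-orbit : ∀ {i} → i < k → iter g i v ≡ x (τ i)
    g-orbit i<k = exchange-orbit _ (<⇒≤ i<k)

  Rho-exchange : Rho (exchange v p f) v k (transpose ℕ._≟_ (suc p) (2 + p) t)
  Rho-exchange = record
    { injective = λ i<k j<k eq → transpose-injective ℕ._≟_ (suc p) (2 + p)
                    (injective (τ< i<k) (τ< j<k) (trans (sym (g-orbit i<k)) (trans eq (g-orbit j<k))))
    ; closes    = begin
        iter g k v      ≡⟨ exchange-orbit k ≤-refl ⟩
        x (τ k)         ≡⟨ cong x τ-fixes-k ⟩
        x k             ≡⟨ closes ⟩
        x t             ≡⟨ cong x (transpose-involutive ℕ._≟_ (suc p) (2 + p) t) ⟨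
        x (τ (τ t))     ≡⟨ g-orbit (τ< tail<) ⟨
        iter g (τ t) v  ∎
    ; tail<     = τ< tail<
    }

  exchange-involutive : exchange v p (exchange v p f) ≡ f
  exchange-involutive = begin
    exchange v p g                   ≡⟨ tabulate∘lookup _ ⟨
    tabulate (app (exchange v p g))  ≡⟨ tabulate-cong twice-exchanged ⟩
    tabulate (app f)                 ≡⟨ tabulate∘lookup f ⟩
    f                                ∎
    where
    g-p : iter g p v ≡ x p
    g-p = trans (g-orbit p<k) (cong x (transpose-other ℕ._≟_ (<⇒≢ (n<1+n p)) (<⇒≢ (m<n⇒m<1+n (n<1+n p)))))

    g-1+p : iter g (suc p) v ≡ x (2 + p)
    g-1+p = trans (g-orbit 1+p<k) (cong x (transpose-matchˡ ℕ._≟_ (suc p) (2 + p)))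

    g-2+p : iter g (2 + p) v ≡ x (suc p)
    g-2+p = trans (g-orbit 2+p<k) (cong x (transpose-matchʳ ℕ._≟_ (suc p) (2 + p)))

    twice-exchanged : ∀ y → app (exchange v p g) y ≡ app f y
    twice-exchanged y = begin
      app (exchange v p g) y               ≡⟨ app-exchange v p g g-p g-1+p g-2+p y ⟩
      app g (tr₀₁ (tr₀₂ y))                ≡⟨ app-exchange v p f refl refl refl _ ⟩
      app f (tr₀₂ (tr₀₁ (tr₀₁ (tr₀₂ y))))  ≡⟨ cong (app f ∘ tr₀₂) (transpose-involutive Fin._≟_ _ _ (tr₀₂ y)) ⟩
      app f (tr₀₂ (tr₀₂ y))                ≡⟨ cong (app f) (transpose-involutive Fin._≟_ _ _ y) ⟩
      app f y                              ∎

-- Counting the events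

module _ {n} (d : Vec ℕ n) (v : Fin n) {k : ℕ} where

  #evSixTail-step : ∀ p → 2 + p < k → #𝔉 d (evSixTail v k (suc p)) ≡ #𝔉 d (evSixTail v k (2 + p))
  #evSixTail-step p 2+p<k =
    count-exchange (evSixTail v k (suc p)) (evSixTail v k (2 + p)) (exchange v p)
      (𝔉-unique d) (λ {f} → ∘ᵐ-∈-𝔉 d (orbitCycle v p f)) forth back involutive disjoint
    where
    forth : ∀ {f} → T (evSixTail v k (suc p) f) → T (evSixTail v k (2 + p) (exchange v p f))
    forth ev = Rho⇒evSixTail (subst (Rho _ v k) (transpose-matchˡ ℕ._≟_ (suc p) (2 + p))
                                                (Rho-exchange (evSixTail⇒Rho ev) 2+p<k))

    back : ∀ {f} → T (evSixTail v k (2 + p) f) → T (evSixTail v k (suc p) (exchange v p f))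
    back ev = Rho⇒evSixTail (subst (Rho _ v k) (transpose-matchʳ ℕ._≟_ (suc p) (2 + p))
                                               (Rho-exchange (evSixTail⇒Rho ev) 2+p<k))

    involutive : ∀ {f} → T (evSixTail v k (suc p) f) ⊎ T (evSixTail v k (2 + p) f) →
                 exchange v p (exchange v p f) ≡ f
    involutive (inj₁ ev) = exchange-involutive (evSixTail⇒Rho ev) 2+p<k
    involutive (inj₂ ev) = exchange-involutive (evSixTail⇒Rho ev) 2+p<k

    disjoint : ∀ {f} → T (evSixTail v k (suc p) f) → ¬ T (evSixTail v k (2 + p) f)
    disjoint ev ev′ = 1+n≢n (sym (proj₂ (Rho-unique _ v (evSixTail⇒Rho ev) (evSixTail⇒Rho ev′))))

  #evSixTail-constant : ∀ t → 1 ≤ t → t < k → #𝔉 d (evSixTail v k t) ≡ #𝔉 d (evSixTail v k 1)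
  #evSixTail-constant (suc zero)    _ _     = refl
  #evSixTail-constant (suc (suc p)) _ 2+p<k =
    trans (sym (#evSixTail-step p 2+p<k))
          (#evSixTail-constant (suc p) (s≤s z≤n) (<-trans (n<1+n _) 2+p<k))

  evSixTailPos⇒tail-range : ∀ {f} → T (evSixTailPos v k f) → 1 ≤ tail f v × tail f v < k
  evSixTailPos⇒tail-range {f} ev with six f v ℕ.≟ k
  ... | yes refl = <ᵇ⇒< 0 (tail f v) ev , Rho.tail< (Rho-six-tail f v)

  evSixTailPos-fibre : ∀ {t} → 1 ≤ t → ∀ f →
                       evSixTailPos v k f ∧ ⌊ tail f v ℕ.≟ t ⌋ ≡ evSixTail v k t f
  evSixTailPos-fibre {t} 1≤t f with six f v ℕ.≟ k
  ... | no _  = refl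
  ... | yes _ with tail f v ℕ.≟ t
  ...   | yes refl = trans (∧-identityʳ _) (Equivalence.to T-≡ (<⇒<ᵇ 1≤t))
  ...   | no _     = ∧-zeroʳ _

lemma3p12 : (n : ℕ) (d : Vec ℕ n) → sum d ≡ n → (v : Fin n) →
            0 < #𝔉 d (evTailPos v) →
            (k : ℕ) → 2 ≤ k → 0 < #𝔉 d (evSixTailPos v k) →
            (j : ℕ) → 1 ≤ j → j ≤ k ∸ 1 →
            (k ∸ 1) * #𝔉 d (evSixTail v k j) ≡ #𝔉 d (evSixTailPos v k)
lemma3p12 n d _ v _ k (s≤s (s≤s z≤n)) _ j 1≤j j≤k∸1 = begin
  (k ∸ 1) * #𝔉 d (evSixTail v k j)
    ≡⟨ cong ((k ∸ 1) *_) (#evSixTail-constant d v j 1≤j (s≤s j≤k∸1)) ⟩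
  (k ∸ 1) * #𝔉 d (evSixTail v k 1)
    ≡⟨ count-fibres (λ f → tail f v) (𝔉 d) (k ∸ 1) (evSixTailPos v k) range fibre ⟨
  #𝔉 d (evSixTailPos v k)
    ∎
  where
  range : ∀ f → T (evSixTailPos v k f) → 1 ≤ tail f v × tail f v ≤ k ∸ 1
  range f ev = map₂ ≤-pred (evSixTailPos⇒tail-range d v ev)

  fibre : ∀ t → 1 ≤ t → t ≤ k ∸ 1 →
          count (λ f → evSixTailPos v k f ∧ ⌊ tail f v ℕ.≟ t ⌋) (𝔉 d) ≡ #𝔉 d (evSixTail v k 1)
  fibre t 1≤t t≤k∸1 =
    trans (count-≗ (evSixTailPos-fibre d v 1≤t) (𝔉 d)) (#evSixTail-constant d v t 1≤t (s≤s t≤k∸1))
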